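{- Let $s,t$ be coprime integers greater than $1$. Suppose $\lambda,\mu$ are partitions with $\mathrm{cor}_s(\lambda)=\mathrm{cor}_s(\mu)$ and $\mathrm{cor}_t(\lambda)=\mathrm{cor}_t(\mu)$, and that $x\in\mathbb Z$ is a pinch-point for $\lambda$. Then $|\mu|\ge|\lambda|$, with equality if and only if $x$ is also a pinch-point for $\mu$.
   Context: Partitions, size $|\lambda|$, beta-set $\mathcal B(\lambda)=\{\lambda_r-r:r\ge1\}$. $\mathrm{cor}_s(\lambda)$ is the $s$-core, obtained by repeatedly removing rim $s$-hooks (connected sets of $s$ rim nodes whose removal leaves a partition's diagram). For $x\in\mathbb Z$ let $\mathcal U_x=\{x+as+bt:a,b>0\}$, $\mathcal L_x=\{x-as-bt:a,b\ge0\}$, $\mathcal R_x=\{x+as-bt:1\le a\le t,\ 0\le b\le s-1\}$. An integer $x$ is a pinch-point for $\lambda$ if $\mathcal L_x\subseteq\mathcal B(\lambda)\subseteq\mathcal L_x\cup\mathcal R_x$. -}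

module Defs where

open import Data.Nat as ℕ using (ℕ; zero; suc; _≤_; _<_)
open import Data.Integer as ℤ using (ℤ; +_)
open import Data.List using (List; []; _∷_)
open import Data.Nat.ListAction using (sum)
open import Data.Product using (Σ; ∃; ∃-syntax; _×_; _,_)
open import Data.Sum using (_⊎_)
open import Relation.Nullary using (¬_)
open import Relation.Binary.PropositionalEquality using (_≡_)
open import Relation.Binary.Construct.Closure.ReflexiveTransitive using (Star)

data IsPartition : List ℕ → Set where
  []   : IsPartition []
  [_]  : ∀ {a} → 0 < a → IsPartition (a ∷ [])
  cons : ∀ {a b l} → b ≤ a → IsPartition (b ∷ l) → IsPartition (a ∷ b ∷ l)

-- row λ i = λ_{i+1}  (rows indexed from 0; 0 beyond the length)
row : List ℕ → ℕ → ℕ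
row []      _       = 0
row (a ∷ _) zero    = a
row (_ ∷ l) (suc i) = row l i

size : List ℕ → ℕ
size = sum

-- Young diagrams. A node is (i , j) (row i, column j, both 0-indexed);
-- (i , j) lies in the diagram of λ iff j < row λ i.

Node : Set
Node = ℕ × ℕ

data Adj : Node → Node → Set where
  right : ∀ {i j} → Adj (i , j) (i , suc j)
  left  : ∀ {i j} → Adj (i , suc j) (i , j)
  down  : ∀ {i j} → Adj (i , j) (suc i , j)
  up    : ∀ {i j} → Adj (suc i , j) (i , j)

data Path (P : Node → Set) : Node → Node → Set where
  here : ∀ {c} → P c → Path P c c
  step : ∀ {c d e} → P c → Adj c d → Path P d e → Path P c e

Connected : (Node → Set) → Set
Connected P = ∀ c d → P c → P d → Path P c d

SkewNode : List ℕ → List ℕ → Node → Set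
SkewNode la mu (i , j) = row mu i ≤ j × j < row la i

RimNode : List ℕ → Node → Set
RimNode la (i , j) = ¬ (suc j < row la (suc i))

record RemoveRimHook (s : ℕ) (la mu : List ℕ) : Set where
  field
    resultPartition : IsPartition mu
    contained       : ∀ i → row mu i ≤ row la i
    hookSize        : size la ≡ size mu ℕ.+ s
    allRim          : ∀ c → SkewNode la mu c → RimNode la c
    connected       : Connected (SkewNode la mu)

IsCore : ℕ → List ℕ → Set
IsCore s c = ¬ (∃[ mu ] RemoveRimHook s c mu)

IsCoreOf : ℕ → List ℕ → List ℕ → Set
IsCoreOf s la c = Star (RemoveRimHook s) la c × IsCore s c

SameCore : ℕ → List ℕ → List ℕ → Set
SameCore s la mu = ∃[ c ] (IsCoreOf s la c × IsCoreOf s mu c)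

InBeta : List ℕ → ℤ → Set
InBeta la z = ∃[ r ] (z ≡ + row la r ℤ.- + suc r)

InL : ℕ → ℕ → ℤ → ℤ → Set
InL s t x z = ∃[ a ] ∃[ b ] (z ≡ x ℤ.- + a ℤ.* + s ℤ.- + b ℤ.* + t)

InR : ℕ → ℕ → ℤ → ℤ → Set
InR s t x z = ∃[ a ] ∃[ b ]
  ((1 ≤ a × a ≤ t) × (b ≤ s ℕ.∸ 1) × (z ≡ x ℤ.+ + a ℤ.* + s ℤ.- + b ℤ.* + t))

IsPinchPoint : ℕ → ℕ → List ℕ → ℤ → Set
IsPinchPoint s t la x =
  (∀ z → InL s t x z → InBeta la z) × (∀ z → InBeta la z → InL s t x z ⊎ InR s t x z)

-- Write z = x + a s − b t with 0 ≤ b < s and a = ā + k t with 1 ≤ ā ≤ t, and call k the level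
-- of z. Then L_x is the set of integers of negative level and R_x that of level zero, so x is a
-- pinch-point for λ iff B(λ) contains every integer of negative level and none of positive level.
-- Now z = (x − b t) + ā s + k s t, the first summand being s-periodic and the second t-periodic
-- in z, and removing a rim s-hook lowers one beta-number by s. Summing over the first N
-- beta-numbers, if λ and μ have the same s- and t-cores then
--   |μ| − |λ| = s t Σ_z k(z) (1_B(μ)(z) − 1_B(λ)(z)).
-- When x is a pinch-point for λ every summand is ≥ 0, and all vanish iff x is a pinch-point for μ.
module Submission where

open import Defs
open import Data.Nat using (ℕ; _≤_; _<_)
open import Data.Nat.Coprimality using (Coprime)
open import Data.Integer using (ℤ)
open import Data.List using (List)
open import Data.Product using (_×_)
open import Function.Bundles using (_⇔_)
open import Relation.Binary.PropositionalEquality using (_≡_)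

open import Algebra.Bundles using (AbelianGroup)
import Algebra.Properties.Group as GroupProperties
open import Data.Empty using (⊥-elim)
open import Data.Integer as ℤ using (+_; -[1+_]; +[1+_]; _+_; _*_; _-_; -_; 0ℤ; 1ℤ)
open import Data.Integer.DivMod using (a≡a%n+[a/n]*n; n%d<d)
import Data.Integer.Properties as ℤ
open import Data.Integer.Tactic.RingSolver using (solve-∀)
open import Data.List using ([]; _∷_; length)
open import Data.Nat as ℕ using (zero; suc; z≤n; s≤s)
open import Data.Nat.Coprimality using (coprime-Bézout)
open import Data.Nat.GCD using (module Bézout)
import Data.Nat.Properties as ℕ
open import Data.Product using (∃; ∃-syntax; _,_; proj₁; proj₂)
open import Data.Sum using (_⊎_; inj₁; inj₂)
open import Function.Base using (_∘_; case_of_)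
open import Function.Bundles using (Equivalence; mk⇔)
open import Function.Construct.Composition using (_⇔-∘_)
open import Function.Construct.Symmetry using (⇔-sym)
open import Level using (0ℓ)
open import Relation.Binary.Construct.Closure.ReflexiveTransitive using (Star; ε; _◅_)
open import Relation.Binary.Definitions using (tri<; tri≈; tri>)
open import Relation.Binary.PropositionalEquality
  using (_≢_; refl; sym; trans; cong; cong₂; subst; module ≡-Reasoning)
open import Relation.Nullary using (¬_; yes; no)
open import Relation.Unary using (Pred; Decidable)

open GroupProperties (AbelianGroup.group ℤ.+-0-abelianGroup)
  using (∙-cancelˡ; ∙-cancelʳ; x∙y⁻¹≈ε⇒x≈y)

restrict : ∀ {P : ℕ → Set} {n} → (∀ r → r < suc n → P r) → ∀ r → r < n → P r
restrict h r r<n = h r (ℕ.m<n⇒m<1+n r<n)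

sumTo : ℕ → (ℕ → ℤ) → ℤ
sumTo zero    f = 0ℤ
sumTo (suc n) f = sumTo n f + f n

sumTo-cong : ∀ n {f g : ℕ → ℤ} → (∀ r → r < n → f r ≡ g r) → sumTo n f ≡ sumTo n g
sumTo-cong zero    f≗g = refl
sumTo-cong (suc n) f≗g =
  cong₂ _+_ (sumTo-cong n (restrict f≗g)) (f≗g n ℕ.≤-refl)

sumTo-distrib-+ : ∀ n (f g : ℕ → ℤ) → sumTo n (λ r → f r + g r) ≡ sumTo n f + sumTo n g
sumTo-distrib-+ zero    f g = refl
sumTo-distrib-+ (suc n) f g =
  trans (cong (_+ (f n + g n)) (sumTo-distrib-+ n f g)) (swap (sumTo n f) (sumTo n g) (f n) (g n))
  where
  swap : ∀ a b c d → a + b + (c + d) ≡ a + c + (b + d)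
  swap = solve-∀

sumTo-distrib-sub : ∀ n (f g : ℕ → ℤ) → sumTo n (λ r → f r - g r) ≡ sumTo n f - sumTo n g
sumTo-distrib-sub zero    f g = refl
sumTo-distrib-sub (suc n) f g =
  trans (cong (_+ (f n - g n)) (sumTo-distrib-sub n f g)) (swap (sumTo n f) (sumTo n g) (f n) (g n))
  where
  swap : ∀ a b c d → a - b + (c - d) ≡ a + c - (b + d)
  swap = solve-∀

sumTo-*ˡ : ∀ n c (f : ℕ → ℤ) → sumTo n (λ r → c * f r) ≡ c * sumTo n f
sumTo-*ˡ zero    c f = sym (ℤ.*-zeroʳ c)
sumTo-*ˡ (suc n) c f =
  trans (cong (_+ c * f n) (sumTo-*ˡ n c f)) (sym (ℤ.*-distribˡ-+ c (sumTo n f) (f n)))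

sumTo-unfoldˡ : ∀ n (f : ℕ → ℤ) → sumTo (suc n) f ≡ f 0 + sumTo n (f ∘ suc)
sumTo-unfoldˡ zero    f = trans (ℤ.+-identityˡ (f 0)) (sym (ℤ.+-identityʳ (f 0)))
sumTo-unfoldˡ (suc n) f = trans (cong (_+ f (suc n)) (sumTo-unfoldˡ n f)) (ℤ.+-assoc (f 0) _ _)

sumTo-zeros : ∀ n (f : ℕ → ℤ) → (∀ r → r < n → f r ≡ 0ℤ) → sumTo n f ≡ 0ℤ
sumTo-zeros zero    f f≡0 = refl
sumTo-zeros (suc n) f f≡0 =
  cong₂ _+_ (sumTo-zeros n f (restrict f≡0)) (f≡0 n ℕ.≤-refl)

sumTo-nonneg : ∀ n (f : ℕ → ℤ) → (∀ r → r < n → 0ℤ ℤ.≤ f r) → 0ℤ ℤ.≤ sumTo n f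
sumTo-nonneg zero    f f≥0 = ℤ.≤-refl
sumTo-nonneg (suc n) f f≥0 =
  ℤ.+-mono-≤ (sumTo-nonneg n f (restrict f≥0)) (f≥0 n ℕ.≤-refl)

nonneg-+≡0 : ∀ {a b} → 0ℤ ℤ.≤ a → 0ℤ ℤ.≤ b → a + b ≡ 0ℤ → a ≡ 0ℤ × b ≡ 0ℤ
nonneg-+≡0 {+ zero} {+ zero} _ _ _  = refl , refl
nonneg-+≡0 {+ zero} {+[1+ b ]} _ _ ()
nonneg-+≡0 {+[1+ a ]} {+ b} _ _ ()

sumTo-nonneg≡0 : ∀ n (f : ℕ → ℤ) → (∀ r → r < n → 0ℤ ℤ.≤ f r) → sumTo n f ≡ 0ℤ →
                 ∀ r → r < n → f r ≡ 0ℤ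
sumTo-nonneg≡0 (suc n) f f≥0 Σ≡0 r r<1+n
  with nonneg-+≡0 (sumTo-nonneg n f (restrict f≥0)) (f≥0 n ℕ.≤-refl) Σ≡0 | ℕ.m≤n⇒m<n∨m≡n (ℕ.≤-pred r<1+n)
... | prefix≡0 , _ | inj₁ r<n  = sumTo-nonneg≡0 n f (restrict f≥0) prefix≡0 r r<n
... | _ , last≡0   | inj₂ refl = last≡0

sumTo-comm : ∀ n m (h : ℕ → ℕ → ℤ) →
  sumTo n (λ i → sumTo m (h i)) ≡ sumTo m (λ r → sumTo n (λ i → h i r))
sumTo-comm zero    m h = sym (sumTo-zeros m _ (λ _ _ → refl))
sumTo-comm (suc n) m h =
  trans (cong (_+ sumTo m (h n)) (sumTo-comm n m h))
        (sym (sumTo-distrib-+ m (λ r → sumTo n (λ i → h i r)) (h n)))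

-- Up to reordering, b is a with the value a i replaced by b j.
module _ (a b : ℕ → ℤ) {i j : ℕ} (i≤j : i ≤ j)
         (below : ∀ r → r < i → b r ≡ a r)
         (above : ∀ r → j < r → b r ≡ a r)
         (inside : ∀ r → i ≤ r → r < j → b r ≡ a (suc r)) where

  private
    exchange : ∀ x y z → x + y + z ≡ x + z + y
    exchange = solve-∀

    sumTo-rotate-prefix : ∀ m → i ≤ m → m ≤ j → sumTo m b + a i ≡ sumTo (suc m) a
    sumTo-rotate-prefix m i≤m m≤j with ℕ.m≤n⇒m<n∨m≡n i≤m
    ... | inj₂ refl = cong (_+ a i) (sumTo-cong i below)
    sumTo-rotate-prefix (suc m) _ m<j | inj₁ i<m = begin
      sumTo m b + b m + a i     ≡⟨ exchange (sumTo m b) (b m) (a i) ⟩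
      sumTo m b + a i + b m     ≡⟨ cong₂ _+_ (sumTo-rotate-prefix m i≤m′ (ℕ.<⇒≤ m<j)) (inside m i≤m′ m<j) ⟩
      sumTo (suc m) a + a (suc m) ∎
      where
      open ≡-Reasoning
      i≤m′ : i ≤ m
      i≤m′ = ℕ.≤-pred i<m

  sumTo-rotate : ∀ n → j < n → sumTo n b + a i ≡ sumTo n a + b j
  sumTo-rotate (suc n) j<1+n with ℕ.m≤n⇒m<n∨m≡n (ℕ.≤-pred j<1+n)
  ... | inj₂ refl = begin
    sumTo j b + b j + a i     ≡⟨ exchange (sumTo j b) (b j) (a i) ⟩
    sumTo j b + a i + b j     ≡⟨ cong (_+ b j) (sumTo-rotate-prefix j i≤j ℕ.≤-refl) ⟩
    sumTo (suc j) a + b j     ∎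
    where open ≡-Reasoning
  ... | inj₁ j<n = begin
    sumTo n b + b n + a i     ≡⟨ exchange (sumTo n b) (b n) (a i) ⟩
    sumTo n b + a i + b n     ≡⟨ cong₂ _+_ (sumTo-rotate n j<n) (above n j<n) ⟩
    sumTo n a + b j + a n     ≡⟨ exchange (sumTo n a) (b j) (a n) ⟩
    sumTo n a + a n + b j     ∎
    where open ≡-Reasoning

δ : ℤ → ℤ → ℤ
δ y z with y ℤ.≟ z
... | yes _ = 1ℤ
... | no  _ = 0ℤ

δ-refl : ∀ z → δ z z ≡ 1ℤ
δ-refl z with z ℤ.≟ z
... | yes _  = refl
... | no z≢z = ⊥-elim (z≢z refl)

δ-≢ : ∀ {y z} → y ≢ z → δ y z ≡ 0ℤ
δ-≢ {y} {z} y≢z with y ℤ.≟ z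
... | yes y≡z = ⊥-elim (y≢z y≡z)
... | no  _   = refl

offset-injective : ∀ lo {i j} → lo + + i ≡ lo + + j → i ≡ j
offset-injective lo eq = ℤ.+-injective (∙-cancelˡ lo _ _ eq)

sumTo-δ : ∀ W (g : ℕ → ℤ) lo {j} → j < W → sumTo W (λ i → g i * δ (lo + + j) (lo + + i)) ≡ g j
sumTo-δ (suc W) g lo {j} j<1+W with ℕ.m≤n⇒m<n∨m≡n (ℕ.≤-pred j<1+W)
... | inj₁ j<W = begin
  sumTo W (λ i → g i * δ (lo + + j) (lo + + i)) + g W * δ (lo + + j) (lo + + W)
    ≡⟨ cong₂ _+_ (sumTo-δ W g lo j<W) (cong (g W *_) (δ-≢ (ℕ.<⇒≢ j<W ∘ offset-injective lo))) ⟩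
  g j + g W * 0ℤ
    ≡⟨ cong (_+_ (g j)) (ℤ.*-zeroʳ (g W)) ⟩
  g j + 0ℤ
    ≡⟨ ℤ.+-identityʳ (g j) ⟩
  g j ∎
  where open ≡-Reasoning
... | inj₂ refl = begin
  sumTo j (λ i → g i * δ (lo + + j) (lo + + i)) + g j * δ (lo + + j) (lo + + j)
    ≡⟨ cong₂ _+_ (sumTo-zeros j _ missed) (cong (g j *_) (δ-refl (lo + + j))) ⟩
  0ℤ + g j * 1ℤ
    ≡⟨ trans (ℤ.+-identityˡ _) (ℤ.*-identityʳ (g j)) ⟩
  g j ∎
  where
  open ≡-Reasoning
  missed : ∀ i → i < j → g i * δ (lo + + j) (lo + + i) ≡ 0ℤ
  missed i i<j = trans (cong (g i *_) (δ-≢ (ℕ.<⇒≢ i<j ∘ sym ∘ offset-injective lo))) (ℤ.*-zeroʳ (g i))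

sumTo-δ-injective : ∀ n (f : ℕ → ℤ) z → (∀ r r′ → f r ≡ f r′ → r ≡ r′) →
  (sumTo n (λ r → δ (f r) z) ≡ 0ℤ × (∀ r → r < n → f r ≢ z)) ⊎
  (sumTo n (λ r → δ (f r) z) ≡ 1ℤ × ∃ λ r → r < n × f r ≡ z)
sumTo-δ-injective zero    f z f-inj = inj₁ (refl , λ r ())
sumTo-δ-injective (suc n) f z f-inj with sumTo-δ-injective n f z f-inj | f n ℤ.≟ z
... | inj₁ (Σ≡0 , miss) | yes fn≡z =
  inj₂ (cong (_+ 1ℤ) Σ≡0 , n , ℕ.≤-refl , fn≡z)
... | inj₁ (Σ≡0 , miss) | no fn≢z = inj₁ (cong (_+ 0ℤ) Σ≡0 , miss′)
  where
  miss′ : ∀ r → r < suc n → f r ≢ z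
  miss′ r r<1+n with ℕ.m≤n⇒m<n∨m≡n (ℕ.≤-pred r<1+n)
  ... | inj₁ r<n  = miss r r<n
  ... | inj₂ refl = fn≢z
... | inj₂ (_ , r , r<n , fr≡z) | yes fn≡z =
  ⊥-elim (ℕ.<⇒≢ r<n (f-inj r n (trans fr≡z (sym fn≡z))))
... | inj₂ (Σ≡1 , r , r<n , fr≡z) | no fn≢z =
  inj₂ (cong (_+ 0ℤ) Σ≡1 , r , ℕ.m<n⇒m<1+n r<n , fr≡z)

≤-of-positive-multiple : ∀ {a b n} k → + a - + b ≡ +[1+ k ] * + suc n → suc n ≤ a
≤-of-positive-multiple {a} {b} {n} k eq = subst (suc n ℕ.≤_) (sym a≡b+m) (begin
  suc n                    ≤⟨ ℕ.m≤n*m (suc n) (suc k) ⟩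
  suc k ℕ.* suc n          ≤⟨ ℕ.m≤n+m _ b ⟩
  b ℕ.+ suc k ℕ.* suc n    ∎)
  where
  open ℕ.≤-Reasoning
  move : ∀ x y → x ≡ y + (x - y)
  move = solve-∀
  a≡b+m : a ≡ b ℕ.+ suc k ℕ.* suc n
  a≡b+m = ℤ.+-injective (trans (move (+ a) (+ b)) (trans (cong (_+_ (+ b)) eq)
            (trans (cong (_+_ (+ b)) (ℤ.pos-* (suc k) (suc n))) (sym (ℤ.pos-+ b _)))))

residue-unique : ∀ {a b n} m → a < suc n → b < suc n → + a - + b ≡ m * + suc n → a ≡ b
residue-unique {a} {b} {n} (+ zero) _ _ eq =
  ℤ.+-injective (x∙y⁻¹≈ε⇒x≈y (+ a) (+ b) (trans eq (ℤ.*-zeroˡ (+ suc n))))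
residue-unique {a} {b} {n} +[1+ k ] a<n _ eq =
  ⊥-elim (ℕ.<⇒≱ a<n (≤-of-positive-multiple {a} {b} {n} k eq))
residue-unique {a} {b} {n} -[1+ k ] _ b<n eq =
  ⊥-elim (ℕ.<⇒≱ b<n (≤-of-positive-multiple {b} {a} {n} k (trans (flip (+ a) (+ b))
    (trans (cong -_ eq) (sym (ℤ.neg-distribˡ-* -[1+ k ] (+ suc n)))))))
  where
  flip : ∀ x y → y - x ≡ - (x - y)
  flip = solve-∀

pos-1+*≡* : ∀ a b c d → 1 ℕ.+ a ℕ.* b ≡ c ℕ.* d → 1ℤ + + a * + b ≡ + c * + d
pos-1+*≡* a b c d eq = trans (cong (_+_ 1ℤ) (sym (ℤ.pos-* a b)))
  (trans (sym (ℤ.pos-+ 1 (a ℕ.* b))) (trans (cong +_ eq) (ℤ.pos-* c d)))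

bezoutℤ : ∀ {s t} → Coprime s t → ∃[ u ] ∃[ v ] u * + s + v * + t ≡ 1ℤ
bezoutℤ {s} {t} coprime with coprime-Bézout coprime
... | Bézout.+- a b eq = + a , - + b , (begin
  + a * + s + - + b * + t      ≡⟨ cong (λ w → w + - + b * + t) (sym (pos-1+*≡* b t a s eq)) ⟩
  1ℤ + + b * + t + - + b * + t ≡⟨ cancel (+ b) (+ t) ⟩
  1ℤ                           ∎)
  where
  open ≡-Reasoning
  cancel : ∀ w t → 1ℤ + w * t + - w * t ≡ 1ℤ
  cancel = solve-∀
... | Bézout.-+ a b eq = - + a , + b , (begin
  - + a * + s + + b * + t        ≡⟨ cong (_+_ (- + a * + s)) (sym (pos-1+*≡* a s b t eq)) ⟩
  - + a * + s + (1ℤ + + a * + s) ≡⟨ cancel (+ a) (+ s) ⟩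
  1ℤ                             ∎)
  where
  open ≡-Reasoning
  cancel : ∀ w s → - w * s + (1ℤ + w * s) ≡ 1ℤ
  cancel = solve-∀

module Coordinates (s′ t′ : ℕ) (u v : ℤ) (bezout : u * + suc s′ + v * + suc t′ ≡ 1ℤ) (x : ℤ) where

  S T : ℤ
  S = + suc s′
  T = + suc t′

  private
    unshift : ∀ r q → r ≡ r + q - q
    unshift = solve-∀

  abstract
    bQuot : ℤ → ℤ
    bQuot z = ((x - z) * v) ℤ./ S

    b : ℤ → ℕ
    b z = ((x - z) * v) ℤ.% S

    b<s : ∀ z → b z < suc s′
    b<s z = n%d<d ((x - z) * v) S

    b-spec : ∀ z → (x - z) * v ≡ + b z + bQuot z * S
    b-spec z = a≡a%n+[a/n]*n ((x - z) * v) S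

  b-def : ∀ z → + b z ≡ (x - z) * v - bQuot z * S
  b-def z = trans (unshift (+ b z) (bQuot z * S)) (cong (_- bQuot z * S) (sym (b-spec z)))

  a : ℤ → ℤ
  a z = (z - x) * u - bQuot z * T

  a-spec : ∀ z → a z * S - + b z * T ≡ z - x
  a-spec z = begin
    a z * S - + b z * T                        ≡⟨ cong (λ w → a z * S - w * T) (b-def z) ⟩
    a z * S - ((x - z) * v - bQuot z * S) * T  ≡⟨ expand z x u v (bQuot z) S T ⟩
    (z - x) * (u * S + v * T)                  ≡⟨ cong (_*_ (z - x)) bezout ⟩
    (z - x) * 1ℤ                               ≡⟨ ℤ.*-identityʳ (z - x) ⟩
    z - x                                      ∎
    where
    open ≡-Reasoning
    expand : ∀ z x u v q S T →
      ((z - x) * u - q * T) * S - ((x - z) * v - q * S) * T ≡ (z - x) * (u * S + v * T)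
    expand = solve-∀

  z≡x+aS-bT : ∀ z → z ≡ x + a z * S - + b z * T
  z≡x+aS-bT z =
    trans (shift z x) (trans (cong (_+_ x) (sym (a-spec z))) (regroup x (a z * S) (+ b z * T)))
    where
    shift : ∀ z x → z ≡ x + (z - x)
    shift = solve-∀
    regroup : ∀ x y w → x + (y - w) ≡ x + y - w
    regroup = solve-∀

  abstract
    level : ℤ → ℤ
    level z = (a z - 1ℤ) ℤ./ T

    āPred : ℤ → ℕ
    āPred z = (a z - 1ℤ) ℤ.% T

    āPred<t : ∀ z → āPred z < suc t′
    āPred<t z = n%d<d (a z - 1ℤ) T

    āPred-spec : ∀ z → a z - 1ℤ ≡ + āPred z + level z * T
    āPred-spec z = a≡a%n+[a/n]*n (a z - 1ℤ) T

  ā : ℤ → ℕ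
  ā z = suc (āPred z)

  a≡ā+level*T : ∀ z → a z ≡ + ā z + level z * T
  a≡ā+level*T z = trans (unpred (a z)) (trans (cong (_+ 1ℤ) (āPred-spec z)) (regroup (+ āPred z) (level z * T)))
    where
    unpred : ∀ w → w ≡ w - 1ℤ + 1ℤ
    unpred = solve-∀
    regroup : ∀ r w → r + w + 1ℤ ≡ 1ℤ + r + w
    regroup = solve-∀

  sPart tPart : ℤ → ℤ
  sPart z = x - + b z * T
  tPart z = + ā z * S

  decompose : ∀ z → z ≡ sPart z + tPart z + level z * (S * T)
  decompose z = begin
    z                                              ≡⟨ z≡x+aS-bT z ⟩
    x + a z * S - + b z * T                        ≡⟨ cong (λ w → x + w * S - + b z * T) (a≡ā+level*T z) ⟩
    x + (+ ā z + level z * T) * S - + b z * T      ≡⟨ regroup x (+ ā z) (level z) (+ b z) S T ⟩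
    sPart z + tPart z + level z * (S * T)          ∎
    where
    open ≡-Reasoning
    regroup : ∀ x a k b S T → x + (a + k * T) * S - b * T ≡ x - b * T + a * S + k * (S * T)
    regroup = solve-∀

  sPart-periodic : ∀ z → sPart (z + S) ≡ sPart z
  sPart-periodic z = cong (λ w → x - + w * T)
    (residue-unique (bQuot z - bQuot (z + S) - v) (b<s (z + S)) (b<s z) (begin
      + b (z + S) - + b z
        ≡⟨ cong₂ _-_ (b-def (z + S)) (b-def z) ⟩
      ((x - (z + S)) * v - bQuot (z + S) * S) - ((x - z) * v - bQuot z * S)
        ≡⟨ collect z x v (bQuot z) (bQuot (z + S)) S ⟩
      (bQuot z - bQuot (z + S) - v) * S ∎))
    where
    open ≡-Reasoning
    collect : ∀ z x v q q′ S → ((x - (z + S)) * v - q′ * S) - ((x - z) * v - q * S) ≡ (q - q′ - v) * S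
    collect = solve-∀

  tPart-periodic : ∀ z → tPart (z + T) ≡ tPart z
  tPart-periodic z = cong (λ w → + suc w * S)
    (residue-unique m (āPred<t (z + T)) (āPred<t z) (begin
      + āPred (z + T) - + āPred z
        ≡⟨ cong₂ _-_ (āPred-def (z + T)) (āPred-def z) ⟩
      (((z + T) - x) * u - bQuot (z + T) * T - 1ℤ - level (z + T) * T)
        - ((z - x) * u - bQuot z * T - 1ℤ - level z * T)
        ≡⟨ collect z x u (bQuot z) (bQuot (z + T)) (level z) (level (z + T)) T ⟩
      m * T ∎))
    where
    open ≡-Reasoning
    m : ℤ
    m = u + bQuot z - bQuot (z + T) - level (z + T) + level z
    āPred-def : ∀ w → + āPred w ≡ a w - 1ℤ - level w * T
    āPred-def w = trans (unshift (+ āPred w) (level w * T)) (cong (_- level w * T) (sym (āPred-spec w)))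
    collect : ∀ z x u q q′ k k′ T →
      (((z + T) - x) * u - q′ * T - 1ℤ - k′ * T) - ((z - x) * u - q * T - 1ℤ - k * T)
        ≡ (u + q - q′ - k′ + k) * T
    collect = solve-∀

  representation-shift : ∀ {z A B} → z ≡ x + A * S - B * T →
                         ∃ λ m → (B - + b z ≡ m * S) × (A - a z ≡ m * T)
  representation-shift {z} {A} {B} hz = m , B-shift , A-shift
    where
    open ≡-Reasoning
    ΔA ΔB : ℤ
    ΔA = A - a z
    ΔB = B - + b z
    AS-BT : A * S - B * T ≡ z - x
    AS-BT = trans (unshift-x A B x S T) (cong (_- x) (sym hz))
      where
      unshift-x : ∀ A B x S T → A * S - B * T ≡ (x + A * S - B * T) - x
      unshift-x = solve-∀
    ΔA*S≡ΔB*T : ΔA * S ≡ ΔB * T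
    ΔA*S≡ΔB*T = x∙y⁻¹≈ε⇒x≈y _ _ (begin
      ΔA * S - ΔB * T                                 ≡⟨ regroup A B (a z) (+ b z) S T ⟩
      (A * S - B * T) - (a z * S - + b z * T)         ≡⟨ cong₂ _-_ AS-BT (a-spec z) ⟩
      (z - x) - (z - x)                               ≡⟨ ℤ.+-inverseʳ (z - x) ⟩
      0ℤ                                              ∎)
      where
      regroup : ∀ A B a b S T → (A - a) * S - (B - b) * T ≡ (A * S - B * T) - (a * S - b * T)
      regroup = solve-∀
    m : ℤ
    m = ΔB * u + ΔA * v
    B-shift : ΔB ≡ m * S
    B-shift = sym (begin
      (ΔB * u + ΔA * v) * S     ≡⟨ regroup ΔB ΔA u v S ⟩
      ΔB * u * S + ΔA * S * v   ≡⟨ cong (λ w → ΔB * u * S + w * v) ΔA*S≡ΔB*T ⟩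
      ΔB * u * S + ΔB * T * v   ≡⟨ factor ΔB u v S T ⟩
      ΔB * (u * S + v * T)      ≡⟨ cong (_*_ ΔB) bezout ⟩
      ΔB * 1ℤ                   ≡⟨ ℤ.*-identityʳ ΔB ⟩
      ΔB                        ∎)
      where
      regroup : ∀ X Y u v S → (X * u + Y * v) * S ≡ X * u * S + Y * S * v
      regroup = solve-∀
      factor : ∀ X u v S T → X * u * S + X * T * v ≡ X * (u * S + v * T)
      factor = solve-∀
    A-shift : ΔA ≡ m * T
    A-shift = ℤ.*-cancelʳ-≡ ΔA (m * T) S (begin
      ΔA * S      ≡⟨ ΔA*S≡ΔB*T ⟩
      ΔB * T      ≡⟨ cong (_* T) B-shift ⟩
      m * S * T   ≡⟨ swap m S T ⟩
      m * T * S   ∎)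
      where
      swap : ∀ m S T → m * S * T ≡ m * T * S
      swap = solve-∀

  a-minimal : ∀ {z A B} → z ≡ x + A * S - + B * T → ∃ λ k → A ≡ a z + + k * T
  a-minimal {z} {A} {B} hz = nonneg (representation-shift {z} {A} {+ B} hz)
    where
    unshift′ : ∀ A a → A ≡ a + (A - a)
    unshift′ = solve-∀
    flip : ∀ x y → y - x ≡ - (x - y)
    flip = solve-∀
    nonneg : (∃ λ m → (+ B - + b z ≡ m * S) × (A - a z ≡ m * T)) → ∃ λ k → A ≡ a z + + k * T
    nonneg (+ k , _ , A-shift) = k , trans (unshift′ A (a z)) (cong (_+_ (a z)) A-shift)
    nonneg (-[1+ k ] , B-shift , _) = ⊥-elim (ℕ.<⇒≱ (b<s z) (≤-of-positive-multiple {b z} {B} {s′} k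
      (trans (flip (+ B) (+ b z)) (trans (cong -_ B-shift) (sym (ℤ.neg-distribˡ-* -[1+ k ] S))))))

  pos-+-*T : ∀ p k → + p + + k * T ≡ + (p ℕ.+ k ℕ.* suc t′)
  pos-+-*T p k = trans (cong (_+_ (+ p)) (sym (ℤ.pos-* k (suc t′)))) (sym (ℤ.pos-+ p _))

  a-of-nonneg-level : ∀ {z n} → level z ≡ + n → a z ≡ + (ā z ℕ.+ n ℕ.* suc t′)
  a-of-nonneg-level {z} {n} eq = trans (a≡ā+level*T z) (trans (cong (λ w → + ā z + w * T) eq) (pos-+-*T (ā z) n))

  InL⇒level<0 : ∀ {z} → InL (suc s′) (suc t′) x z → ∃ λ n → level z ≡ -[1+ n ]
  InL⇒level<0 {z} (A , B , hz) = by-level (level z) refl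
    where
    negate : ∀ x A B S T → x - A * S - B * T ≡ x + (- A) * S - B * T
    negate = solve-∀
    neg≢suc : ∀ A {m} → - + A ≢ +[1+ m ]
    neg≢suc zero    ()
    neg≢suc (suc A) ()
    by-level : ∀ w → level z ≡ w → ∃ λ n → level z ≡ -[1+ n ]
    by-level -[1+ n ] eq = n , eq
    by-level (+ n)    eq = ⊥-elim (neg≢suc A (begin
      - + A                                       ≡⟨ proj₂ shifted ⟩
      a z + + k * T                               ≡⟨ cong (_+ + k * T) (a-of-nonneg-level {z} {n} eq) ⟩
      + (ā z ℕ.+ n ℕ.* suc t′) + + k * T          ≡⟨ pos-+-*T (ā z ℕ.+ n ℕ.* suc t′) k ⟩
      + (ā z ℕ.+ n ℕ.* suc t′ ℕ.+ k ℕ.* suc t′)   ∎))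
      where
      open ≡-Reasoning
      shifted : ∃ λ k → - + A ≡ a z + + k * T
      shifted = a-minimal {z} { - + A} {B} (trans hz (negate x (+ A) (+ B) S T))
      k : ℕ
      k = proj₁ shifted

  InR⇒level≤0 : ∀ {z n} → InR (suc s′) (suc t′) x z → level z ≢ +[1+ n ]
  InR⇒level≤0 {z} {n} (A , B , (_ , A≤t) , _ , hz) eq =
    ℕ.<⇒≱ (ℕ.<-≤-trans (s≤s A≤t) t<) (ℕ.≤-reflexive (sym (ℤ.+-injective (begin
      + A                                             ≡⟨ proj₂ shifted ⟩
      a z + + k * T                                   ≡⟨ cong (_+ + k * T) (a-of-nonneg-level {z} {suc n} eq) ⟩
      + (ā z ℕ.+ suc n ℕ.* suc t′) + + k * T          ≡⟨ pos-+-*T (ā z ℕ.+ suc n ℕ.* suc t′) k ⟩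
      + (ā z ℕ.+ suc n ℕ.* suc t′ ℕ.+ k ℕ.* suc t′)   ∎))))
    where
    open ≡-Reasoning
    shifted : ∃ λ k → + A ≡ a z + + k * T
    shifted = a-minimal {z} {+ A} {B} hz
    k : ℕ
    k = proj₁ shifted
    t< : suc (suc t′) ≤ ā z ℕ.+ suc n ℕ.* suc t′ ℕ.+ k ℕ.* suc t′
    t< = s≤s (ℕ.≤-trans (ℕ.m≤n*m (suc t′) (suc n))
               (ℕ.≤-trans (ℕ.m≤n+m _ (āPred z)) (ℕ.m≤m+n _ (k ℕ.* suc t′))))

  level<0⇒InL : ∀ {z n} → level z ≡ -[1+ n ] → InL (suc s′) (suc t′) x z
  level<0⇒InL {z} {n} eq = N ℕ.∸ ā z , b z , (begin
    z                                   ≡⟨ z≡x+aS-bT z ⟩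
    x + a z * S - + b z * T             ≡⟨ cong (λ w → x + w * S - + b z * T) a≡-A ⟩
    x + - + (N ℕ.∸ ā z) * S - + b z * T ≡⟨ negate x (+ (N ℕ.∸ ā z)) (+ b z) S T ⟩
    x - + (N ℕ.∸ ā z) * S - + b z * T   ∎)
    where
    open ≡-Reasoning
    negate : ∀ x A B S T → x + (- A) * S - B * T ≡ x - A * S - B * T
    negate = solve-∀
    N : ℕ
    N = suc n ℕ.* suc t′
    a≡-A : a z ≡ - + (N ℕ.∸ ā z)
    a≡-A = begin
      a z                                 ≡⟨ a≡ā+level*T z ⟩
      + ā z + level z * T                 ≡⟨ cong (λ w → + ā z + w * T) eq ⟩
      + ā z + -[1+ n ] * T                ≡⟨ cong (_+_ (+ ā z)) (sym (ℤ.neg-distribˡ-* (+ suc n) T)) ⟩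
      + ā z - + suc n * T                 ≡⟨ cong (λ w → + ā z - w) (sym (ℤ.pos-* (suc n) (suc t′))) ⟩
      + ā z - + N                         ≡⟨ cong (λ w → + ā z - + w) (sym (ℕ.m+[n∸m]≡n ā≤N)) ⟩
      + ā z - + (ā z ℕ.+ (N ℕ.∸ ā z))     ≡⟨ cong (λ w → + ā z - w) (ℤ.pos-+ (ā z) _) ⟩
      + ā z - (+ ā z + + (N ℕ.∸ ā z))     ≡⟨ cancel (+ ā z) (+ (N ℕ.∸ ā z)) ⟩
      - + (N ℕ.∸ ā z)                     ∎
      where
      ā≤N : ā z ≤ N
      ā≤N = ℕ.≤-trans (āPred<t z) (ℕ.m≤n*m (suc t′) (suc n))
      cancel : ∀ a b → a - (a + b) ≡ - b
      cancel = solve-∀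

  level≡0⇒InR : ∀ {z} → level z ≡ 0ℤ → InR (suc s′) (suc t′) x z
  level≡0⇒InR {z} eq = ā z , b z , ((s≤s z≤n , āPred<t z) , ℕ.≤-pred (b<s z) , goal)
    where
    goal : z ≡ x + + ā z * S - + b z * T
    goal = trans (z≡x+aS-bT z) (cong (λ w → x + w * S - + b z * T)
             (trans (a≡ā+level*T z) (trans (cong (λ w → + ā z + w * T) eq) (drop (+ ā z) T))))
      where
      drop : ∀ a T → a + 0ℤ * T ≡ a
      drop = solve-∀

  PinchedAt : List ℕ → ℤ → Set
  PinchedAt p z = (∀ {n} → level z ≡ -[1+ n ] → InBeta p z) × (∀ {n} → level z ≡ +[1+ n ] → ¬ InBeta p z)

  Pinched : List ℕ → Set
  Pinched p = ∀ z → PinchedAt p z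

  level>0⇒∉L∪R : ∀ {z n} → level z ≡ +[1+ n ] → ¬ (InL (suc s′) (suc t′) x z ⊎ InR (suc s′) (suc t′) x z)
  level>0⇒∉L∪R {z} eq (inj₁ z∈L) with () ← trans (sym eq) (proj₂ (InL⇒level<0 {z} z∈L))
  level>0⇒∉L∪R eq (inj₂ z∈R) = InR⇒level≤0 z∈R eq

  pinchPoint⇔pinched : ∀ p → IsPinchPoint (suc s′) (suc t′) p x ⇔ Pinched p
  pinchPoint⇔pinched p = mk⇔ to from
    where
    to : IsPinchPoint (suc s′) (suc t′) p x → Pinched p
    to (L⊆B , B⊆L∪R) z = (λ eq → L⊆B z (level<0⇒InL eq)) , (λ eq z∈B → level>0⇒∉L∪R eq (B⊆L∪R z z∈B))

    by-level : ∀ z w → level z ≡ w → PinchedAt p z → InBeta p z →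
               InL (suc s′) (suc t′) x z ⊎ InR (suc s′) (suc t′) x z
    by-level z -[1+ n ] eq _               _   = inj₁ (level<0⇒InL eq)
    by-level z (+ zero) eq _               _   = inj₂ (level≡0⇒InR eq)
    by-level z +[1+ n ] eq (_ , positive∉) z∈B = ⊥-elim (positive∉ eq z∈B)

    from : Pinched p → IsPinchPoint (suc s′) (suc t′) p x
    from pinched = (λ z z∈L → proj₁ (pinched z) (proj₂ (InL⇒level<0 {z} z∈L))) ,
                   (λ z → by-level z (level z) refl (pinched z))

row-antitone-suc : ∀ {p} → IsPartition p → ∀ r → row p (suc r) ≤ row p r
row-antitone-suc []          r       = z≤n
row-antitone-suc [ _ ]       r       = z≤n
row-antitone-suc (cons b≤a _) zero   = b≤a
row-antitone-suc (cons _ ip) (suc r) = row-antitone-suc ip r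

row-antitone : ∀ {p} → IsPartition p → ∀ {r r′} → r ≤ r′ → row p r′ ≤ row p r
row-antitone ip {r} {r′} r≤r′ with ℕ.m≤n⇒m<n∨m≡n r≤r′
... | inj₂ refl = ℕ.≤-refl
row-antitone ip {r} {suc r′} _ | inj₁ r<1+r′ =
  ℕ.≤-trans (row-antitone-suc ip r′) (row-antitone ip (ℕ.≤-pred r<1+r′))

row≤size : ∀ p r → row p r ≤ size p
row≤size []      r       = z≤n
row≤size (a ∷ p) zero    = ℕ.m≤m+n a _
row≤size (a ∷ p) (suc r) = ℕ.≤-trans (row≤size p r) (ℕ.m≤n+m _ a)

Bounded : ℕ → List ℕ → Set
Bounded N p = ∀ r → N ≤ r → row p r ≡ 0

length-Bounded : ∀ p → Bounded (length p) p
length-Bounded []      r       _         = refl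
length-Bounded (a ∷ p) (suc r) (s≤s le) = length-Bounded p r le

Bounded-mono : ∀ {N M p} → N ≤ M → Bounded N p → Bounded M p
Bounded-mono N≤M bounded r M≤r = bounded r (ℕ.≤-trans N≤M M≤r)

sumTo-row : ∀ N p → Bounded N p → sumTo N (λ r → + row p r) ≡ + size p
sumTo-row N       []      _       = sumTo-zeros N _ (λ _ _ → refl)
sumTo-row zero    (a ∷ p) bounded with bounded 0 z≤n
... | refl = sumTo-row zero p (λ r _ → bounded (suc r) z≤n)
sumTo-row (suc N) (a ∷ p) bounded = begin
  sumTo (suc N) (λ r → + row (a ∷ p) r) ≡⟨ sumTo-unfoldˡ N (λ r → + row (a ∷ p) r) ⟩
  + a + sumTo N (λ r → + row p r)       ≡⟨ cong (_+_ (+ a)) (sumTo-row N p (λ r le → bounded (suc r) (s≤s le))) ⟩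
  + a + + size p                        ≡⟨ ℤ.pos-+ a (size p) ⟨
  + size (a ∷ p)                        ∎
  where open ≡-Reasoning

β : List ℕ → ℕ → ℤ
β p r = + row p r - + suc r

sumTo-β : ∀ N p → Bounded N p → sumTo N (β p) ≡ + size p - sumTo N (λ r → + suc r)
sumTo-β N p bounded =
  trans (sumTo-distrib-sub N (λ r → + row p r) (λ r → + suc r)) (cong (_- _) (sumTo-row N p bounded))

β-strictlyDecreasing : ∀ {p} → IsPartition p → ∀ {r r′} → r < r′ → β p r′ ℤ.< β p r
β-strictlyDecreasing ip r<r′ =
  ℤ.+-mono-≤-< (ℤ.+≤+ (row-antitone ip (ℕ.<⇒≤ r<r′))) (ℤ.neg-mono-< (ℤ.+<+ (s≤s r<r′)))

β-injective : ∀ {p} → IsPartition p → ∀ r r′ → β p r ≡ β p r′ → r ≡ r′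
β-injective ip r r′ eq with ℕ.<-cmp r r′
... | tri≈ _ r≡r′ _ = r≡r′
... | tri< r<r′ _ _ = ⊥-elim (ℤ.<-irrefl (sym eq) (β-strictlyDecreasing ip r<r′))
... | tri> _ _ r′<r = ⊥-elim (ℤ.<-irrefl eq (β-strictlyDecreasing ip r′<r))

module _ {P : Pred ℕ 0ℓ} (P? : Decidable P) where

  least-witness : ∀ n → (∃ λ r → r < n × P r) → ∃ λ i → P i × (∀ r → r < i → ¬ P r)
  least-witness (suc n) (r , r<1+n , Pr) with ℕ.anyUpTo? P? n
  ... | yes earlier = least-witness n earlier
  ... | no  none    = r , Pr , λ r′ r′<r Pr′ → none (r′ , ℕ.<-≤-trans r′<r (ℕ.≤-pred r<1+n) , Pr′)

  greatest-witness : ∀ n → (∀ {r} → P r → r < n) → ∃ P → ∃ λ j → P j × (∀ r → j < r → ¬ P r)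
  greatest-witness zero    bound (r , Pr) = ⊥-elim (ℕ.n≮0 (bound Pr))
  greatest-witness (suc n) bound witness with P? n
  ... | yes Pn = n , Pn , λ r n<r Pr → ℕ.<⇒≱ n<r (ℕ.≤-pred (bound Pr))
  ... | no ¬Pn = greatest-witness n bound′ witness
    where
    bound′ : ∀ {r} → P r → r < n
    bound′ Pr = ℕ.≤∧≢⇒< (ℕ.≤-pred (bound Pr)) (λ { refl → ¬Pn Pr })

Path-head : ∀ {P c e} → Path P c e → P c
Path-head (here Pc)     = Pc
Path-head (step Pc _ _) = Pc

Path-crossing : ∀ {P : Node → Set} {c e} m → Path P c e → proj₁ c ≤ m → m < proj₁ e →
                ∃ λ col → P (m , col) × P (suc m , col)
Path-crossing m (here _)            c≤m m<c = ⊥-elim (ℕ.<⇒≱ m<c c≤m)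
Path-crossing m (step _ right rest) c≤m m<e = Path-crossing m rest c≤m m<e
Path-crossing m (step _ left rest)  c≤m m<e = Path-crossing m rest c≤m m<e
Path-crossing m (step {c = (i , j)} Pc down rest) i≤m m<e with ℕ.m≤n⇒m<n∨m≡n i≤m
... | inj₁ i<m  = Path-crossing m rest i<m m<e
... | inj₂ refl = j , Pc , Path-head rest
Path-crossing m (step _ up rest)    c≤m m<e = Path-crossing m rest (ℕ.≤-trans (ℕ.n≤1+n _) c≤m) m<e

module RimHook {s} (s>0 : 0 < s) {p q : List ℕ} (H : RemoveRimHook s p q) {N} (bounded : Bounded N p) where
  open RemoveRimHook H
  open ≡-Reasoning

  Skew : ℕ → Set
  Skew r = row q r < row p r

  skew? : Decidable Skew
  skew? r = row q r ℕ.<? row p r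

  Bounded-q : Bounded N q
  Bounded-q r N≤r = ℕ.n≤0⇒n≡0 (subst (row q r ≤_) (bounded r N≤r) (contained r))

  unskewed : ∀ {r} → ¬ Skew r → row q r ≡ row p r
  unskewed = ℕ.≤∧≮⇒≡ (contained _)

  skew<N : ∀ {r} → Skew r → r < N
  skew<N {r} skew = ℕ.≰⇒> (λ N≤r → ℕ.n≮0 (subst (row q r <_) (bounded r N≤r) skew))

  rowStart : ∀ {r} → Skew r → SkewNode p q (r , row q r)
  rowStart skew = ℕ.≤-refl , skew

  some-skew : ∃ λ r → r < N × Skew r
  some-skew with ℕ.anyUpTo? skew? N
  ... | yes skew = skew
  ... | no  none = ⊥-elim (ℕ.<⇒≢ s>0 (sym (ℕ.+-cancelˡ-≡ (size q) s 0 (begin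
    size q ℕ.+ s   ≡⟨ hookSize ⟨
    size p         ≡⟨ ℤ.+-injective size-p≡size-q ⟩
    size q         ≡⟨ ℕ.+-identityʳ (size q) ⟨
    size q ℕ.+ 0   ∎))))
    where
    row≡ : ∀ r → r < N → + row p r ≡ + row q r
    row≡ r r<N = cong +_ (sym (unskewed (λ skew → none (r , r<N , skew))))
    size-p≡size-q : + size p ≡ + size q
    size-p≡size-q =
      trans (sym (sumTo-row N p bounded)) (trans (sumTo-cong N row≡) (sumTo-row N q Bounded-q))

  first : ∃ λ i → Skew i × (∀ r → r < i → ¬ Skew r)
  first = least-witness skew? N some-skew

  i : ℕ
  i = proj₁ first

  last : ∃ λ j → Skew j × (∀ r → j < r → ¬ Skew r)
  last = greatest-witness skew? N skew<N (i , proj₁ (proj₂ first))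

  j : ℕ
  j = proj₁ last

  i≤j : i ≤ j
  i≤j = ℕ.≮⇒≥ (λ j<i → proj₂ (proj₂ first) j j<i (proj₁ (proj₂ last)))

  -- The hook crosses from row r to row r + 1 in some column, which gives ≤;
  -- the rim condition at the first skew node of row r gives ≥.
  rim-step : ∀ r → i ≤ r → r < j → suc (row q r) ≡ row p (suc r)
  rim-step r i≤r r<j with Path-crossing r connecting i≤r r<j
    where
    connecting : Path (SkewNode p q) (i , row q i) (j , row q j)
    connecting = connected _ _ (rowStart (proj₁ (proj₂ first))) (rowStart (proj₁ (proj₂ last)))
  ... | col , (q≤col , col<p) , (_ , col<p′) =
    ℕ.≤-antisym (ℕ.≤-<-trans q≤col col<p′)
                (ℕ.≮⇒≥ (allRim (r , row q r) (rowStart (ℕ.≤-<-trans q≤col col<p))))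

  β-rotate : ∀ r → i ≤ r → r < j → β q r ≡ β p (suc r)
  β-rotate r i≤r r<j =
    trans (shift (+ row q r) (+ suc r)) (cong (λ w → + w - + suc (suc r)) (rim-step r i≤r r<j))
    where
    shift : ∀ a b → a - b ≡ (1ℤ + a) - (1ℤ + b)
    shift = solve-∀

  sumTo-hook : ∀ (f : ℤ → ℤ) → sumTo N (λ r → f (β q r)) + f (β p i) ≡ sumTo N (λ r → f (β p r)) + f (β q j)
  sumTo-hook f = sumTo-rotate (λ r → f (β p r)) (λ r → f (β q r)) i≤j
    (λ r r<i → cong (λ w → f (+ w - + suc r)) (unskewed (proj₂ (proj₂ first) r r<i)))
    (λ r j<r → cong (λ w → f (+ w - + suc r)) (unskewed (proj₂ (proj₂ last) r j<r)))
    (λ r i≤r r<j → cong f (β-rotate r i≤r r<j))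
    N (skew<N (proj₁ (proj₂ last)))

  β-last : β q j ≡ β p i - + s
  β-last = trans (unshift (β q j) (+ s)) (cong (_- + s) (sym (∙-cancelˡ (Q - Tₙ) (β p i) (β q j + + s) cancelled)))
    where
    Q Tₙ : ℤ
    Q = + size q
    Tₙ = sumTo N (λ r → + suc r)
    unshift : ∀ b S → b ≡ b + S - S
    unshift = solve-∀
    regroup : ∀ Q T S b → Q + S - T + b ≡ Q - T + (b + S)
    regroup = solve-∀
    cancelled : Q - Tₙ + β p i ≡ Q - Tₙ + (β q j + + s)
    cancelled = begin
      Q - Tₙ + β p i             ≡⟨ cong (_+ β p i) (sumTo-β N q Bounded-q) ⟨
      sumTo N (β q) + β p i      ≡⟨ sumTo-hook (λ z → z) ⟩
      sumTo N (β p) + β q j      ≡⟨ cong (_+ β q j) (sumTo-β N p bounded) ⟩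
      + size p - Tₙ + β q j      ≡⟨ cong (λ w → w - Tₙ + β q j) (trans (cong +_ hookSize) (ℤ.pos-+ (size q) s)) ⟩
      Q + + s - Tₙ + β q j       ≡⟨ regroup Q Tₙ (+ s) (β q j) ⟩
      Q - Tₙ + (β q j + + s)     ∎

  sumTo-periodic : ∀ (g : ℤ → ℤ) → (∀ z → g (z + + s) ≡ g z) →
                   sumTo N (λ r → g (β q r)) ≡ sumTo N (λ r → g (β p r))
  sumTo-periodic g periodic =
    ∙-cancelʳ (g (β p i)) _ _ (trans (sumTo-hook g) (cong (_+_ (sumTo N (λ r → g (β p r)))) g-last))
    where
    cancel : ∀ a S → a - S + S ≡ a
    cancel = solve-∀
    g-last : g (β q j) ≡ g (β p i)
    g-last = trans (sym (periodic (β q j))) (cong g (trans (cong (_+ + s) β-last) (cancel (β p i) (+ s))))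

Star-sumTo-periodic : ∀ {s} → 0 < s → (g : ℤ → ℤ) → (∀ z → g (z + + s) ≡ g z) →
  ∀ {N p c} → Star (RemoveRimHook s) p c → Bounded N p →
  Bounded N c × sumTo N (λ r → g (β c r)) ≡ sumTo N (λ r → g (β p r))
Star-sumTo-periodic s>0 g periodic ε bounded = bounded , refl
Star-sumTo-periodic s>0 g periodic (H ◅ rest) bounded =
  let open RimHook s>0 H bounded
      (bounded-c , eq) = Star-sumTo-periodic s>0 g periodic rest Bounded-q
  in bounded-c , trans eq (sumTo-periodic g periodic)

SameCore-sumTo-periodic : ∀ {s} → 0 < s → (g : ℤ → ℤ) → (∀ z → g (z + + s) ≡ g z) →
  ∀ {N la mu} → SameCore s la mu → Bounded N la → Bounded N mu →
  sumTo N (λ r → g (β mu r)) ≡ sumTo N (λ r → g (β la r))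
SameCore-sumTo-periodic s>0 g periodic (_ , (la↠c , _) , (mu↠c , _)) bl bm =
  trans (sym (proj₂ (Star-sumTo-periodic s>0 g periodic mu↠c bm)))
        (proj₂ (Star-sumTo-periodic s>0 g periodic la↠c bl))

-- The beta-numbers of a partition with at most N rows and size at most SZ are the integers
-- below lo together with N of the positions lo + i, i < W.
module Window (N SZ : ℕ) where

  W : ℕ
  W = SZ ℕ.+ N

  lo : ℤ
  lo = - + N

  window-view : ∀ z → (∃ λ i → z ≡ lo + + i) ⊎ (∃ λ k → z ≡ -[1+ N ℕ.+ k ])
  window-view z = view (z + + N) refl
    where
    shift : ∀ z N → z ≡ - N + (z + N)
    shift = solve-∀
    negate : ∀ a b → - a + - b ≡ - (a + b)
    negate = solve-∀
    view : ∀ w → z + + N ≡ w → (∃ λ i → z ≡ lo + + i) ⊎ (∃ λ k → z ≡ -[1+ N ℕ.+ k ])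
    view (+ i)    eq = inj₁ (i , trans (shift z (+ N)) (cong (_+_ lo) eq))
    view -[1+ k ] eq = inj₂ (k , (begin
      z                        ≡⟨ shift z (+ N) ⟩
      lo + (z + + N)           ≡⟨ cong (_+_ lo) eq ⟩
      - + N + - + suc k        ≡⟨ negate (+ N) (+ suc k) ⟩
      - (+ N + + suc k)        ≡⟨ cong -_ (ℤ.pos-+ N (suc k)) ⟨
      - + (N ℕ.+ suc k)        ≡⟨ cong (-_ ∘ +_) (ℕ.+-suc N k) ⟩
      -[1+ N ℕ.+ k ]           ∎))
      where open ≡-Reasoning

  module Occupancy {p : List ℕ} (ip : IsPartition p) (bounded : Bounded N p) (size≤SZ : size p ≤ SZ) where

    position : ℕ → ℕ
    position r = row p r ℕ.+ (N ℕ.∸ suc r)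

    β≡lo+position : ∀ {r} → r < N → β p r ≡ lo + + position r
    β≡lo+position {r} r<N = begin
      + row p r - + suc r                                               ≡⟨ shift (+ row p r) (+ suc r) (+ (N ℕ.∸ suc r)) ⟩
      - (+ suc r + + (N ℕ.∸ suc r)) + (+ row p r + + (N ℕ.∸ suc r))   ≡⟨ cong₂ (λ a b → - a + b) (ℤ.pos-+ (suc r) _) (ℤ.pos-+ (row p r) _) ⟨
      - + (suc r ℕ.+ (N ℕ.∸ suc r)) + + position r                     ≡⟨ cong (λ w → - + w + + position r) (ℕ.m+[n∸m]≡n r<N) ⟩
      lo + + position r                                                 ∎
      where
      open ≡-Reasoning
      shift : ∀ a b e → a - b ≡ - (b + e) + (a + e)
      shift = solve-∀

    position<W : ∀ {r} → r < N → position r < W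
    position<W {r} r<N = ℕ.+-mono-≤-< (ℕ.≤-trans (row≤size p r) size≤SZ) (ℕ.∸-monoʳ-< {N} {suc r} {0} (s≤s z≤n) r<N)

    below-window : ∀ k → InBeta p -[1+ N ℕ.+ k ]
    below-window k = N ℕ.+ k , sym (trans (cong (λ w → + w - + suc (N ℕ.+ k)) (bounded (N ℕ.+ k) (ℕ.m≤m+n N k)))
                                           (ℤ.+-identityˡ _))

    InBeta-window : ∀ {i} → InBeta p (lo + + i) → ∃ λ r → r < N × β p r ≡ lo + + i
    InBeta-window {i} (r , eq) with N ℕ.≤? r
    ... | no  N≰r = r , ℕ.≰⇒> N≰r , sym eq
    ... | yes N≤r = ⊥-elim (ℕ.<-irrefl refl (ℕ.<-≤-trans (s≤s (ℕ.m≤m+n N (r ℕ.∸ N)))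
                      (ℕ.≤-trans (ℕ.m≤n+m _ i) (ℕ.≤-reflexive (ℤ.+-injective i+r+1≡N)))))
      where
      r+1 : lo + + i ≡ - + suc r
      r+1 = trans eq (trans (cong (λ w → + w - + suc r) (bounded r N≤r)) (ℤ.+-identityˡ _))
      solve-i : ∀ N i r → - N + i ≡ - r → i + r ≡ N
      solve-i N i r h = trans (expand N i r) (trans (cong (λ w → w + r + N) h) (contract N r))
        where
        expand : ∀ N i r → i + r ≡ (- N + i) + r + N
        expand = solve-∀
        contract : ∀ N r → - r + r + N ≡ N
        contract = solve-∀
      i+r+1≡N : + (i ℕ.+ suc (N ℕ.+ (r ℕ.∸ N))) ≡ + N
      i+r+1≡N = trans (ℤ.pos-+ i _) (trans (cong (λ w → + i + + suc w) (ℕ.m+[n∸m]≡n N≤r))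
                  (solve-i (+ N) (+ i) (+ suc r) r+1))

    InBeta⇒<W : ∀ {i} → InBeta p (lo + + i) → i < W
    InBeta⇒<W z∈B with InBeta-window z∈B
    ... | r , r<N , eq = subst (_< W) (offset-injective lo (trans (sym (β≡lo+position r<N)) eq)) (position<W r<N)

    occupied : ℕ → ℤ
    occupied i = sumTo N (λ r → δ (β p r) (lo + + i))

    occupied-cases : ∀ i → (occupied i ≡ 0ℤ × ¬ InBeta p (lo + + i)) ⊎ (occupied i ≡ 1ℤ × InBeta p (lo + + i))
    occupied-cases i with sumTo-δ-injective N (β p) (lo + + i) (β-injective ip)
    ... | inj₂ (occ≡1 , r , _ , eq) = inj₂ (occ≡1 , r , sym eq)
    ... | inj₁ (occ≡0 , miss) = inj₁ (occ≡0 , λ z∈B → let (r , r<N , eq) = InBeta-window z∈B in miss r r<N eq)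

    occupied-∈ : ∀ {i} → InBeta p (lo + + i) → occupied i ≡ 1ℤ
    occupied-∈ {i} z∈B with occupied-cases i
    ... | inj₁ (_ , z∉B) = ⊥-elim (z∉B z∈B)
    ... | inj₂ (occ≡1 , _) = occ≡1

    occupied-∉ : ∀ {i} → ¬ InBeta p (lo + + i) → occupied i ≡ 0ℤ
    occupied-∉ {i} z∉B with occupied-cases i
    ... | inj₁ (occ≡0 , _) = occ≡0
    ... | inj₂ (_ , z∈B) = ⊥-elim (z∉B z∈B)

    sumTo-occupied : ∀ (g : ℤ → ℤ) → sumTo N (λ r → g (β p r)) ≡ sumTo W (λ i → g (lo + + i) * occupied i)
    sumTo-occupied g = begin
      sumTo N (λ r → g (β p r))
        ≡⟨ sumTo-cong N (λ r r<N → trans (cong g (β≡lo+position r<N)) (sym (isolate r<N))) ⟩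
      sumTo N (λ r → sumTo W (λ i → g (lo + + i) * δ (β p r) (lo + + i)))
        ≡⟨ sumTo-comm W N (λ i r → g (lo + + i) * δ (β p r) (lo + + i)) ⟨
      sumTo W (λ i → sumTo N (λ r → g (lo + + i) * δ (β p r) (lo + + i)))
        ≡⟨ sumTo-cong W (λ i _ → sumTo-*ˡ N (g (lo + + i)) (λ r → δ (β p r) (lo + + i))) ⟩
      sumTo W (λ i → g (lo + + i) * occupied i) ∎
      where
      open ≡-Reasoning
      isolate : ∀ {r} → r < N → sumTo W (λ i → g (lo + + i) * δ (β p r) (lo + + i)) ≡ g (lo + + position r)
      isolate {r} r<N = trans (sumTo-cong W (λ i _ → cong (λ w → g (lo + + i) * δ w (lo + + i)) (β≡lo+position r<N)))
                              (sumTo-δ W (λ i → g (lo + + i)) lo (position<W r<N))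

module Comparison (s′ t′ : ℕ) (u v : ℤ) (bezout : u * + suc s′ + v * + suc t′ ≡ 1ℤ) (x : ℤ)
                  {la mu : List ℕ} (ipl : IsPartition la) (ipm : IsPartition mu) where
  open Coordinates s′ t′ u v bezout x

  N SZ : ℕ
  N = length la ℕ.+ length mu
  SZ = size la ℕ.+ size mu

  bounded-la : Bounded N la
  bounded-la = Bounded-mono {p = la} (ℕ.m≤m+n (length la) (length mu)) (length-Bounded la)

  bounded-mu : Bounded N mu
  bounded-mu = Bounded-mono {p = mu} (ℕ.m≤n+m (length mu) (length la)) (length-Bounded mu)

  open Window N SZ
  module L = Occupancy ipl bounded-la (ℕ.m≤m+n (size la) (size mu))
  module M = Occupancy ipm bounded-mu (ℕ.m≤n+m (size mu) (size la))

  gain : ℕ → ℤ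
  gain i = level (lo + + i) * (M.occupied i - L.occupied i)

  sumTo-β-split : ∀ p → Bounded N p →
    + size p - sumTo N (λ r → + suc r) ≡
    sumTo N (λ r → sPart (β p r)) + sumTo N (λ r → tPart (β p r)) + (S * T) * sumTo N (λ r → level (β p r))
  sumTo-β-split p bounded = begin
    + size p - sumTo N (λ r → + suc r)
      ≡⟨ sumTo-β N p bounded ⟨
    sumTo N (β p)
      ≡⟨ sumTo-cong N (λ r _ → trans (decompose (β p r)) (cong (_+_ (sPart (β p r) + tPart (β p r))) (ℤ.*-comm (level (β p r)) (S * T)))) ⟩
    sumTo N (λ r → sPart (β p r) + tPart (β p r) + (S * T) * level (β p r))
      ≡⟨ sumTo-distrib-+ N _ _ ⟩
    sumTo N (λ r → sPart (β p r) + tPart (β p r)) + sumTo N (λ r → (S * T) * level (β p r))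
      ≡⟨ cong₂ _+_ (sumTo-distrib-+ N _ _) (sumTo-*ˡ N (S * T) _) ⟩
    sumTo N (λ r → sPart (β p r)) + sumTo N (λ r → tPart (β p r)) + (S * T) * sumTo N (λ r → level (β p r)) ∎
    where open ≡-Reasoning

  size-difference : SameCore (suc s′) la mu → SameCore (suc t′) la mu →
                    + size mu - + size la ≡ (S * T) * sumTo W gain
  size-difference same-s same-t = begin
    + size mu - + size la
      ≡⟨ subtract (+ size mu) (+ size la) Tₙ ⟩
    (+ size mu - Tₙ) - (+ size la - Tₙ)
      ≡⟨ cong₂ _-_ (sumTo-β-split mu bounded-mu) (sumTo-β-split la bounded-la) ⟩
    (Σs mu + Σt mu + (S * T) * K mu) - (Σs la + Σt la + (S * T) * K la)
      ≡⟨ cong₂ (λ a b → (a + b + (S * T) * K mu) - (Σs la + Σt la + (S * T) * K la)) s-invariant t-invariant ⟩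
    (Σs la + Σt la + (S * T) * K mu) - (Σs la + Σt la + (S * T) * K la)
      ≡⟨ cancel (Σs la) (Σt la) (S * T) (K mu) (K la) ⟩
    (S * T) * (K mu - K la)
      ≡⟨ cong (_*_ (S * T)) K-difference ⟩
    (S * T) * sumTo W gain ∎
    where
    open ≡-Reasoning
    Tₙ : ℤ
    Tₙ = sumTo N (λ r → + suc r)
    Σs Σt K : List ℕ → ℤ
    Σs p = sumTo N (λ r → sPart (β p r))
    Σt p = sumTo N (λ r → tPart (β p r))
    K p = sumTo N (λ r → level (β p r))
    s-invariant : Σs mu ≡ Σs la
    s-invariant = SameCore-sumTo-periodic (s≤s z≤n) sPart sPart-periodic same-s bounded-la bounded-mu
    t-invariant : Σt mu ≡ Σt la
    t-invariant = SameCore-sumTo-periodic (s≤s z≤n) tPart tPart-periodic same-t bounded-la bounded-mu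
    subtract : ∀ a b T → a - b ≡ (a - T) - (b - T)
    subtract = solve-∀
    cancel : ∀ a b c m n → (a + b + c * m) - (a + b + c * n) ≡ c * (m - n)
    cancel = solve-∀
    factor : ∀ a b c → a * b - a * c ≡ a * (b - c)
    factor = solve-∀
    K-difference : K mu - K la ≡ sumTo W gain
    K-difference = trans (cong₂ _-_ (M.sumTo-occupied level) (L.sumTo-occupied level))
      (trans (sym (sumTo-distrib-sub W _ _))
             (sumTo-cong W (λ i _ → factor (level (lo + + i)) (M.occupied i) (L.occupied i))))

  module _ (pinched : Pinched la) where

    la-occupied : ∀ {i n} → level (lo + + i) ≡ -[1+ n ] → L.occupied i ≡ 1ℤ
    la-occupied eq = L.occupied-∈ (proj₁ (pinched _) eq)

    la-unoccupied : ∀ {i n} → level (lo + + i) ≡ +[1+ n ] → L.occupied i ≡ 0ℤ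
    la-unoccupied eq = L.occupied-∉ (proj₂ (pinched _) eq)

    gain-cases : ∀ i → (gain i ≡ 0ℤ × PinchedAt mu (lo + + i)) ⊎
                       (∃ λ n → gain i ≡ +[1+ n ] × ¬ PinchedAt mu (lo + + i))
    gain-cases i = by-level (level z) refl (M.occupied-cases i)
      where
      z : ℤ
      z = lo + + i
      w*[0-1] : ∀ w → w * (0ℤ - 1ℤ) ≡ - w
      w*[0-1] = solve-∀
      w*[1-1] : ∀ w → w * (1ℤ - 1ℤ) ≡ 0ℤ
      w*[1-1] = solve-∀
      w*[0-0] : ∀ w → w * (0ℤ - 0ℤ) ≡ 0ℤ
      w*[0-0] = solve-∀
      w*[1-0] : ∀ w → w * (1ℤ - 0ℤ) ≡ w
      w*[1-0] = solve-∀
      gain-at : ∀ {w a b} → level z ≡ w → M.occupied i ≡ a → L.occupied i ≡ b → gain i ≡ w * (a - b)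
      gain-at eq-w eq-a eq-b = cong₂ _*_ eq-w (cong₂ _-_ eq-a eq-b)
      by-level : ∀ w → level z ≡ w →
                 (M.occupied i ≡ 0ℤ × ¬ InBeta mu z) ⊎ (M.occupied i ≡ 1ℤ × InBeta mu z) →
                 (gain i ≡ 0ℤ × PinchedAt mu z) ⊎ (∃ λ n → gain i ≡ +[1+ n ] × ¬ PinchedAt mu z)
      by-level (+ zero) eq _ =
        inj₁ (trans (cong (_* (M.occupied i - L.occupied i)) eq) (ℤ.*-zeroˡ (M.occupied i - L.occupied i)) ,
              (λ eq′ → case trans (sym eq) eq′ of λ ()) , (λ eq′ → case trans (sym eq) eq′ of λ ()))
      by-level -[1+ n ] eq (inj₁ (occ≡0 , z∉mu)) =
        inj₂ (n , trans (gain-at eq occ≡0 (la-occupied eq)) (w*[0-1] -[1+ n ]) , λ at → z∉mu (proj₁ at eq))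
      by-level -[1+ n ] eq (inj₂ (occ≡1 , z∈mu)) =
        inj₁ (trans (gain-at eq occ≡1 (la-occupied eq)) (w*[1-1] -[1+ n ]) ,
              (λ _ → z∈mu) , (λ eq′ → case trans (sym eq) eq′ of λ ()))
      by-level +[1+ n ] eq (inj₁ (occ≡0 , z∉mu)) =
        inj₁ (trans (gain-at eq occ≡0 (la-unoccupied eq)) (w*[0-0] +[1+ n ]) ,
              (λ eq′ → case trans (sym eq) eq′ of λ ()) , (λ _ → z∉mu))
      by-level +[1+ n ] eq (inj₂ (occ≡1 , z∈mu)) =
        inj₂ (n , trans (gain-at eq occ≡1 (la-unoccupied eq)) (w*[1-0] +[1+ n ]) , λ at → proj₂ at eq z∈mu)

    gain-nonneg : ∀ i → 0ℤ ℤ.≤ gain i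
    gain-nonneg i with gain-cases i
    ... | inj₁ (gain≡0 , _)     = ℤ.≤-reflexive (sym gain≡0)
    ... | inj₂ (_ , gain≡+ , _) = subst (0ℤ ℤ.≤_) (sym gain≡+) (ℤ.+≤+ z≤n)

    pinched⇒gain≡0 : Pinched mu → ∀ i → gain i ≡ 0ℤ
    pinched⇒gain≡0 pinched-mu i with gain-cases i
    ... | inj₁ (gain≡0 , _)          = gain≡0
    ... | inj₂ (_ , _ , ¬pinchedAt) = ⊥-elim (¬pinchedAt (pinched-mu (lo + + i)))

    gain≡0⇒pinched : (∀ i → i < W → gain i ≡ 0ℤ) → Pinched mu
    gain≡0⇒pinched gains≡0 z with window-view z
    ... | inj₂ (k , refl) = (λ _ → M.below-window k) , (λ eq _ → proj₂ (pinched _) eq (L.below-window k))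
    ... | inj₁ (i , refl) =
      (λ eq → proj₁ (in-window (L.InBeta⇒<W (proj₁ (pinched _) eq))) eq) ,
      (λ eq z∈mu → proj₂ (in-window (M.InBeta⇒<W z∈mu)) eq z∈mu)
      where
      in-window : i < W → PinchedAt mu (lo + + i)
      in-window i<W with gain-cases i
      ... | inj₁ (_ , pinchedAt)  = pinchedAt
      ... | inj₂ (_ , gain≡+ , _) = case trans (sym gain≡+) (gains≡0 i i<W) of λ ()

  module _ (same-s : SameCore (suc s′) la mu) (same-t : SameCore (suc t′) la mu) (pinched : Pinched la) where

    size-la≤size-mu : size la ≤ size mu
    size-la≤size-mu = ℤ.drop‿+≤+ (ℤ.0≤i-j⇒j≤i (subst (0ℤ ℤ.≤_) (sym (size-difference same-s same-t)) 0≤ST*gains))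
      where
      0≤ST*gains : 0ℤ ℤ.≤ (S * T) * sumTo W gain
      0≤ST*gains = subst (ℤ._≤ (S * T) * sumTo W gain) (ℤ.*-zeroʳ (S * T))
        (ℤ.*-monoˡ-≤-nonNeg (S * T) (sumTo-nonneg W gain (λ i _ → gain-nonneg pinched i)))

    same-size⇔pinched : (size mu ≡ size la) ⇔ Pinched mu
    same-size⇔pinched = mk⇔ to from
      where
      to : size mu ≡ size la → Pinched mu
      to same-size = gain≡0⇒pinched pinched (sumTo-nonneg≡0 W gain (λ i _ → gain-nonneg pinched i) gains≡0)
        where
        gains≡0 : sumTo W gain ≡ 0ℤ
        gains≡0 = ℤ.*-cancelˡ-≡ (S * T) (sumTo W gain) 0ℤ (begin
          (S * T) * sumTo W gain ≡⟨ size-difference same-s same-t ⟨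
          + size mu - + size la  ≡⟨ cong (λ w → + w - + size la) same-size ⟩
          + size la - + size la  ≡⟨ ℤ.+-inverseʳ (+ size la) ⟩
          0ℤ                     ≡⟨ ℤ.*-zeroʳ (S * T) ⟨
          (S * T) * 0ℤ           ∎)
          where open ≡-Reasoning
      from : Pinched mu → size mu ≡ size la
      from pinched-mu = ℤ.+-injective (x∙y⁻¹≈ε⇒x≈y (+ size mu) (+ size la) (begin
        + size mu - + size la   ≡⟨ size-difference same-s same-t ⟩
        (S * T) * sumTo W gain  ≡⟨ cong (_*_ (S * T)) (sumTo-zeros W gain (λ i _ → pinched⇒gain≡0 pinched pinched-mu i)) ⟩
        (S * T) * 0ℤ            ≡⟨ ℤ.*-zeroʳ (S * T) ⟩
        0ℤ                      ∎))
        where open ≡-Reasoning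

proposition3p3 : (s t : ℕ) → 1 < s → 1 < t → Coprime s t →
    (la mu : List ℕ) → IsPartition la → IsPartition mu →
    SameCore s la mu → SameCore t la mu →
    (x : ℤ) → IsPinchPoint s t la x →
    (size la ≤ size mu) × ((size mu ≡ size la) ⇔ IsPinchPoint s t mu x)
proposition3p3 (suc s′) (suc t′) _ _ coprime la mu ipl ipm same-s same-t x pinchPoint
  with bezoutℤ coprime
... | u , v , bezout =
  size-la≤size-mu same-s same-t pinched ,
  ⇔-sym (pinchPoint⇔pinched mu) ⇔-∘ same-size⇔pinched same-s same-t pinched
  where
  open Coordinates s′ t′ u v bezout x
  open Comparison s′ t′ u v bezout x ipl ipm
  pinched : Pinched la
  pinched = Equivalence.to (pinchPoint⇔pinched la) pinchPoint
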